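{- If $D$ is a strong digraph without an in-dominating vertex, then $\mathsf{d}_s^-(D)\le \delta^+(D)$.
   Context: Digraphs are finite, loopless, without parallel arcs. $D$ is strong if for every ordered pair $u,v$ there is a directed $uv$-walk. $S\subseteq V(D)$ is in-dominating if every vertex not in $S$ has an out-neighbor in $S$; a vertex $v$ is an in-dominating vertex if $\{v\}$ is in-dominating (every other vertex $x$ has $(x,v)\in A(D)$). A strong in-dominating set is an in-dominating set inducing a strong subdigraph. $\mathsf{d}_s^-(D)$ is the maximum number of classes in a partition of $V(D)$ into strong in-dominating sets. $\delta^+(D)$ is the minimum out-degree of $D$. -}

module Defs where

open import Data.Nat using (ℕ; zero; suc; _+_; _⊓_)
open import Data.Fin using (Fin; zero; suc)
open import Data.Bool using (Bool; true; false; if_then_else_)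
open import Data.Product using (Σ; ∃; _×_; _,_)
open import Relation.Binary.PropositionalEquality using (_≡_; _≢_)
open import Relation.Nullary using (¬_)

-- A digraph on vertex set Fin n, given by its arc indicator.
-- (x , y) is an arc iff arc x y ≡ true.  Using a relation rules out
-- parallel arcs; looplessness is an explicit field.
record Digraph (n : ℕ) : Set where
  field
    arc      : Fin n → Fin n → Bool
    loopless : ∀ x → arc x x ≡ false
open Digraph public

Arc : ∀ {n} → Digraph n → Fin n → Fin n → Set
Arc D x y = arc D x y ≡ true

-- Directed walks from u to v all of whose vertices lie in S
-- (the start vertex u is required to be in S separately).
data WalkIn {n} (D : Digraph n) (S : Fin n → Set) : Fin n → Fin n → Set where
  nil  : ∀ {u} → WalkIn D S u u
  cons : ∀ {u w v} → Arc D u w → S w → WalkIn D S w v → WalkIn D S u v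

InducesStrong : ∀ {n} → Digraph n → (Fin n → Set) → Set
InducesStrong D S = ∀ u v → S u → S v → WalkIn D S u v

Strong : ∀ {n} → Digraph n → Set
Strong {n} D = InducesStrong D (λ _ → Fin n)

InDominating : ∀ {n} → Digraph n → (Fin n → Set) → Set
InDominating D S = ∀ x → ¬ S x → ∃ λ y → S y × Arc D x y

InDominatingVertex : ∀ {n} → Digraph n → Fin n → Set
InDominatingVertex D v = ∀ x → x ≢ v → Arc D x v

StrongInDominating : ∀ {n} → Digraph n → (Fin n → Set) → Set
StrongInDominating D S = InDominating D S × InducesStrong D S

-- A partition of V(D) into k (nonempty) strong in-dominating sets,
-- given by a surjective class map; class i is {x | cls x ≡ i}.
record SIDPartition {n} (D : Digraph n) (k : ℕ) : Set where
  field
    cls      : Fin n → Fin k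
    nonempty : ∀ i → ∃ λ x → cls x ≡ i
    sid      : ∀ i → StrongInDominating D (λ x → cls x ≡ i)

count : ∀ {n} → (Fin n → Bool) → ℕ
count {zero}  f = 0
count {suc n} f = (if f zero then 1 else 0) + count (λ i → f (suc i))

outdeg : ∀ {n} → Digraph n → Fin n → ℕ
outdeg D x = count (arc D x)

minF : ∀ {m} → (Fin (suc m) → ℕ) → ℕ
minF {zero}  f = f zero
minF {suc m} f = f zero ⊓ minF (λ i → f (suc i))

δ⁺ : ∀ {m} → Digraph (suc m) → ℕ
δ⁺ D = minF (outdeg D)

-- "d_s^-(D) ≤ d" : the maximum number of classes in a partition into
-- strong in-dominating sets is at most d, i.e. every such partition has
-- at most d classes.
dₛ⁻≤ : ∀ {n} → Digraph n → ℕ → Set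
dₛ⁻≤ D d = ∀ k → SIDPartition D k → k Data.Nat.≤ d

-- Let x be a vertex of minimum out-degree.  Every class S of the partition
-- contains an out-neighbour of x: if x ∉ S, in-domination supplies one; if
-- S = {x}, then x would be an in-dominating vertex; otherwise a walk inside S
-- from x to another vertex of S starts with such an arc.  The classes are
-- disjoint, so these out-neighbours are distinct and k ≤ d⁺(x) = δ⁺(D).

module Submission where

open import Defs
open import Data.Nat using (ℕ; suc; _≤_; _≤?_)
open import Data.Nat.Properties using (m≤n⇒m⊓n≡m; m≥n⇒m⊓n≡n; ≰⇒≥)
open import Data.Fin using (Fin; zero; suc; _≟_)
open import Data.Fin.Properties using (any?; injective⇒≤; suc-injective)
open import Data.Bool using (Bool; true; false)
open import Data.Product using (∃; _×_; _,_; proj₁; proj₂)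
open import Function using (_∘_)
open import Function.Definitions using (Injective)
open import Relation.Nullary using (¬_; yes; no; contradiction)
open import Relation.Nullary.Decidable using (_×-dec_; ¬?; decidable-stable)
open import Relation.Unary using (Decidable)
open import Relation.Binary.PropositionalEquality using (_≡_; _≢_; refl; sym; trans; cong; subst)

minF-attained : ∀ {m} (f : Fin (suc m) → ℕ) → ∃ λ x → minF f ≡ f x
minF-attained {0}     f = zero , refl
minF-attained {suc m} f with minF-attained (f ∘ suc) | f zero ≤? minF (f ∘ suc)
... | _     | yes f₀≤ = zero , m≤n⇒m⊓n≡m f₀≤
... | x , e | no  f₀≰ = suc x , trans (m≥n⇒m⊓n≡n (≰⇒≥ f₀≰)) e

index : ∀ {n} (P : Fin n → Bool) x → P x ≡ true → Fin (count P)
index P zero    Px with P zero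
index P zero    () | false
index P zero    _  | true  = zero
index P (suc x) Px with P zero
... | false = index (P ∘ suc) x Px
... | true  = suc (index (P ∘ suc) x Px)

index-injective : ∀ {n} (P : Fin n → Bool) {x y} (Px : P x ≡ true) (Py : P y ≡ true) →
                  index P x Px ≡ index P y Py → x ≡ y
index-injective P {zero}  {zero}  Px Py e = refl
index-injective P {zero}  {suc y} Px Py e with P zero
index-injective P {zero}  {suc y} () Py e | false
index-injective P {zero}  {suc y} Px Py () | true
index-injective P {suc x} {zero}  Px Py e with P zero
index-injective P {suc x} {zero}  Px () e | false
index-injective P {suc x} {zero}  Px Py () | true
index-injective P {suc x} {suc y} Px Py e with P zero
... | false = cong suc (index-injective (P ∘ suc) Px Py e)
... | true  = cong suc (index-injective (P ∘ suc) Px Py (suc-injective e))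

injective⇒≤count : ∀ {n k} (P : Fin n → Bool) (g : Fin k → Fin n) →
                   Injective _≡_ _≡_ g → (∀ i → P (g i) ≡ true) → k ≤ count P
injective⇒≤count P g g-inj Pg =
  injective⇒≤ (λ {i} {j} e → g-inj (index-injective P (Pg i) (Pg j) e))

WalkIn-firstArc : ∀ {n} {D : Digraph n} {S : Fin n → Set} {u v} →
                  v ≢ u → WalkIn D S u v → ∃ λ w → S w × Arc D u w
WalkIn-firstArc v≢u nil            = contradiction refl v≢u
WalkIn-firstArc _   (cons uw Sw _) = _ , Sw , uw

InDominating-singleton⇒InDominatingVertex :
  ∀ {n} {D : Digraph n} {S : Fin n → Set} {x} →
  InDominating D S → (∀ y → S y → y ≡ x) → InDominatingVertex D x
InDominating-singleton⇒InDominatingVertex {D = D} dom S⊆x z z≢x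
  with dom z (z≢x ∘ S⊆x z)
... | y , Sy , zy = subst (Arc D z) (S⊆x y Sy) zy

StrongInDominating⇒outNeighbour :
  ∀ {n} {D : Digraph n} {S : Fin n → Set} → Decidable S → StrongInDominating D S →
  ∀ x → ¬ InDominatingVertex D x → ∃ λ y → S y × Arc D x y
StrongInDominating⇒outNeighbour {D = D} {S = S} S? (dom , strong) x x-not-IDV with S? x
... | no  ¬Sx = dom x ¬Sx
... | yes Sx  with any? (λ y → S? y ×-dec ¬? (y ≟ x))
...   | yes (y , Sy , y≢x) = WalkIn-firstArc y≢x (strong x y Sx Sy)
...   | no  ¬other         = contradiction
          (InDominating-singleton⇒InDominatingVertex {D = D} dom S⊆x) x-not-IDV
  where
  S⊆x : ∀ y → S y → y ≡ x
  S⊆x y Sy = decidable-stable (y ≟ x) (λ y≢x → ¬other (y , Sy , y≢x))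

proposition3 : ∀ {m} (D : Digraph (suc m)) → Strong D →
               (∀ v → ¬ InDominatingVertex D v) → dₛ⁻≤ D (δ⁺ D)
proposition3 D _ no-IDV k part with minF-attained (outdeg D)
... | x , δ⁺≡outdeg-x =
  subst (k ≤_) (sym δ⁺≡outdeg-x) (injective⇒≤count (arc D x) y y-injective x→y)
  where
  open SIDPartition part
  neighbour : ∀ i → ∃ λ y → cls y ≡ i × Arc D x y
  neighbour i = StrongInDominating⇒outNeighbour (λ y → cls y ≟ i) (sid i) x (no-IDV x)
  y : Fin k → Fin _
  y i = proj₁ (neighbour i)
  y-injective : Injective _≡_ _≡_ y
  y-injective {i} {j} yi≡yj =
    trans (sym (proj₁ (proj₂ (neighbour i)))) (trans (cong cls yi≡yj) (proj₁ (proj₂ (neighbour j))))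
  x→y : ∀ i → Arc D x (y i)
  x→y i = proj₂ (proj₂ (neighbour i))
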